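{- Let $k \in \mathbb{N}$, and let $G$ be the complete bipartite graph with parts $M$ and $N$, where $|N| \geqslant |M| \geqslant 15k$. Let $f$ be an $r$-colouring of $E(G)$, and let $S,T,U \subseteq [r]$ satisfy $S \cup T \cup U = [r]$. Suppose that (a) $|\{v \in N : f(uv) \in S\}| \leqslant k$ for every $u \in M$, and (b) $|\{u \in M : f(uv) \in T\}| \leqslant k$ for every $v \in N$. Then there exists a $k$-connected subgraph of $G$, all of whose edges have colours from $U$, which avoids at most $5k$ vertices of $M$ and at most $2k$ vertices of $N$. In particular, $G$ has a $k$-connected subgraph with all edge colours in $U$ on at least $|G| - 7k$ vertices.
   Context: An $r$-colouring of $E(G)$ is a function $f: E(G) \to [r] = \{1,\dots,r\}$. $|G|$ denotes the number of vertices of $G$. A graph on at least $k+1$ vertices is $k$-connected if deleting any at most $k-1$ vertices leaves a connected graph. -}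

module Defs where

open import Data.Nat using (ℕ; suc; _+_; _*_; _≤_; _<_)
open import Data.Fin using (Fin)
open import Data.Fin.Subset using (Subset; _∈_; _⊆_; _─_; ∣_∣; ∁)
open import Data.Vec using (tabulate; lookup)
open import Data.Bool using (Bool; true)
open import Data.Sum using (_⊎_; inj₁; inj₂)
open import Data.Product using (_×_)
open import Relation.Binary.PropositionalEquality using (_≡_)

Vertex : ℕ → ℕ → Set
Vertex m n = Fin m ⊎ Fin n

EdgeSet : ℕ → ℕ → Set
EdgeSet m n = Fin m → Fin n → Bool

_∈V[_,_] : ∀ {m n} → Vertex m n → Subset m → Subset n → Set
inj₁ u ∈V[ A , B ] = u ∈ A
inj₂ v ∈V[ A , B ] = v ∈ B

Adj : ∀ {m n} → EdgeSet m n → Vertex m n → Vertex m n → Set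
Adj E (inj₁ u) (inj₂ v) = E u v ≡ true
Adj E (inj₂ v) (inj₁ u) = E u v ≡ true
Adj E (inj₁ _) (inj₁ _) = Data.Empty.⊥
  where import Data.Empty
Adj E (inj₂ _) (inj₂ _) = Data.Empty.⊥
  where import Data.Empty

data Reach {m n} (A : Subset m) (B : Subset n) (E : EdgeSet m n)
           (x : Vertex m n) : Vertex m n → Set where
  here : x ∈V[ A , B ] → Reach A B E x x
  step : ∀ {y z} → Reach A B E x y → Adj E y z → z ∈V[ A , B ] → Reach A B E x z

Connected : ∀ {m n} → Subset m → Subset n → EdgeSet m n → Set
Connected A B E = ∀ x y → x ∈V[ A , B ] → y ∈V[ A , B ] → Reach A B E x y

KConnected : ∀ {m n} → ℕ → Subset m → Subset n → EdgeSet m n → Set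
KConnected k A B E =
  suc k ≤ ∣ A ∣ + ∣ B ∣ ×
  (∀ (X : Subset _) (Y : Subset _) → X ⊆ A → Y ⊆ B → ∣ X ∣ + ∣ Y ∣ < k →
     Connected (A ─ X) (B ─ Y) E)

IsUSubgraph : ∀ {m n r} → (Fin m → Fin n → Fin r) → Subset r →
              Subset m → Subset n → EdgeSet m n → Set
IsUSubgraph f U A B E =
  ∀ u v → E u v ≡ true → u ∈ A × v ∈ B × f u v ∈ U

nbrsIn : ∀ {m n r} → (Fin m → Fin n → Fin r) → Subset r → Fin m → Subset n
nbrsIn f S u = tabulate (λ v → lookup S (f u v))

nbrsIn′ : ∀ {m n r} → (Fin m → Fin n → Fin r) → Subset r → Fin n → Subset m
nbrsIn′ f T v = tabulate (λ u → lookup T (f u v))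

{-# OPTIONS --safe #-}
module Submission where

-- Take A = {u : 5 |T-row of u| ≤ n} and B = {v : 2 |S-column of v| ≤ m}. Counting the
-- T-coloured edges column by column bounds the number of rows outside A by 5k, and
-- likewise at most 2k columns lie outside B. After deleting fewer than k vertices, any two
-- vertices of A keep a common neighbour in B along U-coloured edges, because at most
-- 2k + k + 2k + 2n/5 < n columns are ruled out, and every vertex of B keeps a U-neighbour
-- in A, because at most 5k + k + k + m/2 < m rows are ruled out. Hence every vertex
-- reaches A, and A is connected through B.

open import Defs
open import Data.Nat using (ℕ; zero; suc; _+_; _*_; _∸_; _≤_; _<_; _≤?_; z≤n; s≤s; NonZero)
open import Data.Nat.Tactic.RingSolver using (solve-∀)
open import Data.Nat.Properties
open import Data.Fin using (Fin)
open import Data.Fin.Properties using (¬∀⟶∃¬)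
open import Data.Fin.Subset using (Subset; _∈_; _∉_; _⊆_; _─_; _∪_; ⋃; ∣_∣; ∁; ⊤; inside; outside)
open import Data.Fin.Subset.Properties
  using (_∈?_; ∣⊥∣≡0; ∣⊤∣≡n; ∣p∣≤∣x∷p∣; p⊆q⇒∣p∣≤∣q∣; x∈p∪q⁺; x∉∁p⇒x∈p; x∈p∧x∉q⇒x∈p─q; p─q⊆p; ∣∁p∣≡n∸∣p∣)
open import Data.Vec using ([]; _∷_; lookup; tabulate)
open import Data.Vec.Properties using (lookup∘tabulate; []=⇒lookup; lookup⇒[]=)
open import Data.List as List using (List)
open import Data.Nat.ListAction using (sum)
open import Data.List.Relation.Unary.All using (All; []; _∷_)
open import Data.Bool using (Bool; true; false; _∧_; if_then_else_)
open import Data.Bool.Properties using (T-≡)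
open import Data.Sum using (_⊎_; inj₁; inj₂)
open import Data.Product using (_×_; _,_; map₂; ∃-syntax; Σ-syntax)
open import Function using (_∘_; Equivalence)
open import Relation.Binary.PropositionalEquality
open import Relation.Nullary using (yes; no; contradiction)
open import Relation.Nullary.Decidable using (⌊_⌋; toWitness)
open import Algebra.Properties.CommutativeMonoid.Sum +-0-commutativeMonoid using (sum-syntax; ∑-comm; sum-cong-≗)
open import Algebra.Properties.Semiring.Sum +-*-semiring using (*-distribˡ-sum)

open ≤-Reasoning

∣p∪q∣≤∣p∣+∣q∣ : ∀ {n} (p q : Subset n) → ∣ p ∪ q ∣ ≤ ∣ p ∣ + ∣ q ∣
∣p∪q∣≤∣p∣+∣q∣ []            []            = z≤n
∣p∪q∣≤∣p∣+∣q∣ (inside  ∷ p) (s       ∷ q) = s≤s (≤-trans (∣p∪q∣≤∣p∣+∣q∣ p q) (+-monoʳ-≤ ∣ p ∣ (∣p∣≤∣x∷p∣ s q)))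
∣p∪q∣≤∣p∣+∣q∣ (outside ∷ p) (inside  ∷ q) = ≤-trans (s≤s (∣p∪q∣≤∣p∣+∣q∣ p q)) (≤-reflexive (sym (+-suc ∣ p ∣ ∣ q ∣)))
∣p∪q∣≤∣p∣+∣q∣ (outside ∷ p) (outside ∷ q) = ∣p∪q∣≤∣p∣+∣q∣ p q

∣⋃ps∣≤∑∣ps∣ : ∀ {n} (ps : List (Subset n)) → ∣ ⋃ ps ∣ ≤ sum (List.map ∣_∣ ps)
∣⋃ps∣≤∑∣ps∣ {n} List.[] = ≤-reflexive (∣⊥∣≡0 n)
∣⋃ps∣≤∑∣ps∣ (p List.∷ ps) = ≤-trans (∣p∪q∣≤∣p∣+∣q∣ p (⋃ ps)) (+-monoʳ-≤ ∣ p ∣ (∣⋃ps∣≤∑∣ps∣ ps))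

x∉⋃ps⇒x∉ps : ∀ {n} {x : Fin n} (ps : List (Subset n)) → x ∉ ⋃ ps → All (x ∉_) ps
x∉⋃ps⇒x∉ps List.[]        _   = []
x∉⋃ps⇒x∉ps (p List.∷ ps) x∉ = x∉ ∘ x∈p∪q⁺ ∘ inj₁ ∷ x∉⋃ps⇒x∉ps ps (x∉ ∘ x∈p∪q⁺ ∘ inj₂)

∣p∣<n⇒∃x∉p : ∀ {n} (p : Subset n) → ∣ p ∣ < n → ∃[ x ] x ∉ p
∣p∣<n⇒∃x∉p {n} p ∣p∣<n = ¬∀⟶∃¬ n (_∈ p) (_∈? p) λ all∈p →
  <⇒≱ ∣p∣<n (subst (_≤ ∣ p ∣) (∣⊤∣≡n n) (p⊆q⇒∣p∣≤∣q∣ {p = ⊤} (λ {x} _ → all∈p x)))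

∑∣ps∣<n⇒∃x∉ps : ∀ {n} (ps : List (Subset n)) → sum (List.map ∣_∣ ps) < n → ∃[ x ] All (x ∉_) ps
∑∣ps∣<n⇒∃x∉ps ps ∑<n = map₂ (x∉⋃ps⇒x∉ps ps) (∣p∣<n⇒∃x∉p (⋃ ps) (≤-<-trans (∣⋃ps∣≤∑∣ps∣ ps) ∑<n))

∣tabulate∣≡∑ : ∀ {n} (p : Fin n → Bool) → ∣ tabulate p ∣ ≡ ∑[ i < n ] (if p i then 1 else 0)
∣tabulate∣≡∑ {zero}  p = refl
∣tabulate∣≡∑ {suc n} p with p Fin.zero
... | true  = cong suc (∣tabulate∣≡∑ (p ∘ Fin.suc))
... | false = ∣tabulate∣≡∑ (p ∘ Fin.suc)

∑∣rows∣≡∑∣columns∣ : ∀ {m n} (g : Fin m → Fin n → Bool) →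
  ∑[ u < m ] ∣ tabulate (g u) ∣ ≡ ∑[ v < n ] ∣ tabulate (λ u → g u v) ∣
∑∣rows∣≡∑∣columns∣ {m} {n} g = begin-equality
  ∑[ u < m ] ∣ tabulate (g u) ∣                      ≡⟨ sum-cong-≗ (∣tabulate∣≡∑ ∘ g) ⟩
  ∑[ u < m ] ∑[ v < n ] (if g u v then 1 else 0)     ≡⟨ ∑-comm (λ u v → if g u v then 1 else 0) ⟩
  ∑[ v < n ] ∑[ u < m ] (if g u v then 1 else 0)     ≡⟨ sum-cong-≗ (λ v → ∣tabulate∣≡∑ (λ u → g u v)) ⟨
  ∑[ v < n ] ∣ tabulate (λ u → g u v) ∣              ∎

∑≤n*k : ∀ {n k} (w : Fin n → ℕ) → (∀ i → w i ≤ k) → ∑[ i < n ] w i ≤ n * k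
∑≤n*k {zero}  w w≤k = z≤n
∑≤n*k {suc n} w w≤k = +-mono-≤ (w≤k Fin.zero) (∑≤n*k (w ∘ Fin.suc) (w≤k ∘ Fin.suc))

∈-tabulate⁺ : ∀ {n} {p : Fin n → Bool} {i} → p i ≡ true → i ∈ tabulate p
∈-tabulate⁺ {p = p} {i} pi≡true = lookup⇒[]= i (tabulate p) (trans (lookup∘tabulate p i) pi≡true)

∈-tabulate⁻ : ∀ {n} {p : Fin n → Bool} {i} → i ∈ tabulate p → p i ≡ true
∈-tabulate⁻ {p = p} {i} i∈ = trans (sym (lookup∘tabulate p i)) ([]=⇒lookup i∈)

light : ∀ {n} → ℕ → (Fin n → ℕ) → Subset n
light c w = tabulate (λ i → ⌊ w i ≤? c ⌋)

∈-light⁻ : ∀ {n c} {w : Fin n → ℕ} {i} → i ∈ light c w → w i ≤ c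
∈-light⁻ i∈ = toWitness (Equivalence.from T-≡ (∈-tabulate⁻ i∈))

∣∁light∣*[1+c]≤∑ : ∀ {n} c (w : Fin n → ℕ) → ∣ ∁ (light c w) ∣ * suc c ≤ ∑[ i < n ] w i
∣∁light∣*[1+c]≤∑ {zero}  c w = z≤n
∣∁light∣*[1+c]≤∑ {suc n} c w with w Fin.zero ≤? c
... | yes _   = m≤n⇒m≤o+n (w Fin.zero) (∣∁light∣*[1+c]≤∑ c (w ∘ Fin.suc))
... | no  w≰c = +-mono-≤ (≰⇒> w≰c) (∣∁light∣*[1+c]≤∑ c (w ∘ Fin.suc))

∣∁light∣≤ : ∀ {n} c b (w : Fin n → ℕ) → ∑[ i < n ] w i ≤ b * c → ∣ ∁ (light c w) ∣ ≤ b
∣∁light∣≤ c b w ∑≤b*c = *-cancelʳ-≤ _ b (suc c) (begin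
  ∣ ∁ (light c w) ∣ * suc c  ≤⟨ ∣∁light∣*[1+c]≤∑ c w ⟩
  ∑[ i < _ ] w i             ≤⟨ ∑≤b*c ⟩
  b * c                      ≤⟨ *-monoʳ-≤ b (n≤1+n c) ⟩
  b * suc c                  ∎)

∣heavy-rows∣≤ : ∀ {m n k} d (g : Fin m → Fin n → Bool) → (∀ v → ∣ tabulate (λ u → g u v) ∣ ≤ k) →
  ∣ ∁ (light n (λ u → d * ∣ tabulate (g u) ∣)) ∣ ≤ d * k
∣heavy-rows∣≤ {m} {n} {k} d g ∣columns∣≤k = ∣∁light∣≤ {m} n (d * k) (λ u → d * ∣ tabulate (g u) ∣) (begin
  ∑[ u < m ] (d * ∣ tabulate (g u) ∣)    ≡⟨ *-distribˡ-sum d (λ u → ∣ tabulate (g u) ∣) ⟨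
  d * ∑[ u < m ] ∣ tabulate (g u) ∣      ≡⟨ cong (d *_) (∑∣rows∣≡∑∣columns∣ g) ⟩
  d * ∑[ v < n ] ∣ tabulate (λ u → g u v) ∣ ≤⟨ *-monoʳ-≤ d (∑≤n*k _ ∣columns∣≤k) ⟩
  d * (n * k)                            ≡⟨ cong (d *_) (*-comm n k) ⟩
  d * (k * n)                            ≡⟨ *-assoc d k n ⟨
  d * k * n                              ∎)

a+b<N-by-scaling : ∀ d .{{_ : NonZero d}} {a b c e N} → a < c → d * b ≤ e → d * c + e ≤ d * N → a + b < N
a+b<N-by-scaling d {a} {b} {c} {e} {N} a<c d*b≤e d*c+e≤d*N = *-cancelˡ-< d (a + b) N (begin-strict
  d * (a + b)    ≡⟨ *-distribˡ-+ d a b ⟩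
  d * a + d * b  <⟨ +-mono-<-≤ (*-monoʳ-< d a<c) d*b≤e ⟩
  d * c + e      ≤⟨ d*c+e≤d*N ⟩
  d * N          ∎)

common-neighbour-budget : ∀ {k n y b s s′ t t′} → 15 * k ≤ n →
  y < k → b ≤ 2 * k → s ≤ k → s′ ≤ k → 5 * t ≤ n → 5 * t′ ≤ n →
  y + (b + (s + (s′ + (t + (t′ + 0))))) < n
common-neighbour-budget {k} {n} {y} {b} {s} {s′} {t} {t′} 15k≤n y<k b≤2k s≤k s′≤k 5t≤n 5t′≤n =
  subst (_< n) (regroup y b s s′ t t′) (a+b<N-by-scaling 5
    (+-mono-<-≤ y<k (+-mono-≤ b≤2k (+-mono-≤ s≤k s′≤k)))
    (≤-trans (≤-reflexive (*-distribˡ-+ 5 t t′)) (+-mono-≤ 5t≤n 5t′≤n))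
    (begin
      5 * (k + (2 * k + (k + k))) + (n + n)  ≡⟨ 25k+2n k n ⟩
      25 * k + 2 * n                         ≤⟨ +-monoˡ-≤ (2 * n) (*-monoˡ-≤ k (m≤m+n 25 20)) ⟩
      45 * k + 2 * n                         ≡⟨ cong (_+ 2 * n) (*-assoc 3 15 k) ⟩
      3 * (15 * k) + 2 * n                   ≤⟨ +-monoˡ-≤ (2 * n) (*-monoʳ-≤ 3 15k≤n) ⟩
      3 * n + 2 * n                          ≡⟨ *-distribʳ-+ n 3 2 ⟨
      5 * n                                  ∎))
  where
  regroup : ∀ y b s s′ t t′ → (y + (b + (s + s′))) + (t + t′) ≡ y + (b + (s + (s′ + (t + (t′ + 0)))))
  regroup = solve-∀
  25k+2n : ∀ k n → 5 * (k + (2 * k + (k + k))) + (n + n) ≡ 25 * k + 2 * n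
  25k+2n = solve-∀

neighbour-budget : ∀ {k m x a t s} → 15 * k ≤ m →
  x < k → a ≤ 5 * k → t ≤ k → 2 * s ≤ m → x + (a + (t + (s + 0))) < m
neighbour-budget {k} {m} {x} {a} {t} {s} 15k≤m x<k a≤5k t≤k 2s≤m =
  subst (_< m) (regroup x a t s) (a+b<N-by-scaling 2
    (+-mono-<-≤ x<k (+-mono-≤ a≤5k t≤k))
    2s≤m
    (begin
      2 * (k + (5 * k + k)) + m  ≡⟨ 14k+m k m ⟩
      14 * k + m                 ≤⟨ +-monoˡ-≤ m (≤-trans (*-monoˡ-≤ k (m≤m+n 14 1)) 15k≤m) ⟩
      m + m                      ≡⟨ cong (m +_) (+-identityʳ m) ⟨
      2 * m                      ∎))
  where
  regroup : ∀ x a t s → (x + (a + t)) + s ≡ x + (a + (t + (s + 0)))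
  regroup = solve-∀
  14k+m : ∀ k m → 2 * (k + (5 * k + k)) + m ≡ 14 * k + m
  14k+m = solve-∀

15k≤a+5k⇒k<a : ∀ {k a} → 1 ≤ k → 15 * k ≤ a + 5 * k → k < a
15k≤a+5k⇒k<a {k} {a} 1≤k 15k≤a+5k = begin
  suc k   ≤⟨ +-monoˡ-≤ k 1≤k ⟩
  k + k   ≤⟨ +-monoʳ-≤ k (m≤n*m k 9) ⟩
  10 * k  ≤⟨ +-cancelʳ-≤ (5 * k) (10 * k) a (≤-trans (≤-reflexive (sym (*-distribʳ-+ k 10 5))) 15k≤a+5k) ⟩
  a       ∎

module _ {m n} {A : Subset m} {B : Subset n} {E : EdgeSet m n}
  (common-neighbour : ∀ {u u′} → u ∈ A → u′ ∈ A → ∃[ w ] (w ∈ B × E u w ≡ true × E u′ w ≡ true))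
  (neighbour : ∀ {v} → v ∈ B → ∃[ u ] (u ∈ A × E u v ≡ true)) where

  private
    reach-into-A : ∀ x → x ∈V[ A , B ] → ∃[ u ] (u ∈ A × Reach A B E x (inj₁ u))
    reach-into-A (inj₁ u) u∈A = u , u∈A , here u∈A
    reach-into-A (inj₂ v) v∈B with neighbour v∈B
    ... | u , u∈A , uv = u , u∈A , step (here v∈B) uv u∈A

    reach-within-A : ∀ {x u u′} → u ∈ A → u′ ∈ A → Reach A B E x (inj₁ u) → Reach A B E x (inj₁ u′)
    reach-within-A u∈A u′∈A x⇝u with common-neighbour u∈A u′∈A
    ... | w , w∈B , uw , u′w = step (step {z = inj₂ w} x⇝u uw w∈B) u′w u′∈A

    reach-out-of-A : ∀ {x u} y → u ∈ A → y ∈V[ A , B ] → Reach A B E x (inj₁ u) → Reach A B E x y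
    reach-out-of-A (inj₁ u′) u∈A u′∈A x⇝u = reach-within-A u∈A u′∈A x⇝u
    reach-out-of-A (inj₂ v)  u∈A v∈B  x⇝u with neighbour v∈B
    ... | u′ , u′∈A , u′v = step (reach-within-A u∈A u′∈A x⇝u) u′v v∈B

  connected-by-common-neighbours : Connected A B E
  connected-by-common-neighbours x y x∈ y∈ with reach-into-A x x∈
  ... | u , u∈A , x⇝u = reach-out-of-A y u∈A y∈ x⇝u

module Construction {k m n r} (f : Fin m → Fin n → Fin r) (S T U : Subset r)
  (cover : ∀ c → c ∈ S ⊎ (c ∈ T ⊎ c ∈ U))
  (∣S-row∣≤k : ∀ u → ∣ nbrsIn f S u ∣ ≤ k)
  (∣T-column∣≤k : ∀ v → ∣ nbrsIn′ f T v ∣ ≤ k) where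

  A : Subset m
  A = light n (λ u → 5 * ∣ nbrsIn f T u ∣)

  B : Subset n
  B = light m (λ v → 2 * ∣ nbrsIn′ f S v ∣)

  E : EdgeSet m n
  E u v = lookup A u ∧ (lookup B v ∧ lookup U (f u v))

  ∣∁A∣≤5k : ∣ ∁ A ∣ ≤ 5 * k
  ∣∁A∣≤5k = ∣heavy-rows∣≤ 5 (λ u v → lookup T (f u v)) ∣T-column∣≤k

  ∣∁B∣≤2k : ∣ ∁ B ∣ ≤ 2 * k
  ∣∁B∣≤2k = ∣heavy-rows∣≤ 2 (λ v u → lookup S (f u v)) ∣S-row∣≤k

  private
    ∧-≡true⁻ : ∀ {a b} → a ∧ b ≡ true → a ≡ true × b ≡ true
    ∧-≡true⁻ {true} b≡true = refl , b≡true

    edge⁺ : ∀ {u v} → u ∈ A → v ∈ B → f u v ∈ U → E u v ≡ true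
    edge⁺ u∈A v∈B c∈U = cong₂ _∧_ ([]=⇒lookup u∈A) (cong₂ _∧_ ([]=⇒lookup v∈B) ([]=⇒lookup c∈U))

    colour∉nbrs : ∀ {l} {P : Subset r} (g : Fin l → Fin r) {i} → i ∉ tabulate (λ j → lookup P (g j)) → g i ∉ P
    colour∉nbrs g i∉ = i∉ ∘ ∈-tabulate⁺ ∘ []=⇒lookup

    colour∈U : ∀ {c} → c ∉ S → c ∉ T → c ∈ U
    colour∈U {c} c∉S c∉T with cover c
    ... | inj₁ c∈S        = contradiction c∈S c∉S
    ... | inj₂ (inj₁ c∈T) = contradiction c∈T c∉T
    ... | inj₂ (inj₂ c∈U) = c∈U

  E-isUSubgraph : IsUSubgraph f U A B E
  E-isUSubgraph u v uv∈E with ∧-≡true⁻ uv∈E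
  ... | u∈A , vc∈BU with ∧-≡true⁻ vc∈BU
  ... | v∈B , c∈U = lookup⇒[]= u A u∈A , lookup⇒[]= v B v∈B , lookup⇒[]= (f u v) U c∈U

  common-neighbour : 15 * k ≤ n → ∀ {u u′} (Y : Subset n) → u ∈ A → u′ ∈ A → ∣ Y ∣ < k →
    ∃[ w ] (w ∈ B ─ Y × E u w ≡ true × E u′ w ≡ true)
  common-neighbour 15k≤n {u} {u′} Y u∈A u′∈A ∣Y∣<k = choose (∑∣ps∣<n⇒∃x∉ps excluded budget)
    where
    excluded : List (Subset n)
    excluded = Y List.∷ ∁ B List.∷ nbrsIn f S u List.∷ nbrsIn f S u′ List.∷
               nbrsIn f T u List.∷ nbrsIn f T u′ List.∷ List.[]

    budget : sum (List.map ∣_∣ excluded) < n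
    budget = common-neighbour-budget {t = ∣ nbrsIn f T u ∣} {t′ = ∣ nbrsIn f T u′ ∣}
               15k≤n ∣Y∣<k ∣∁B∣≤2k (∣S-row∣≤k u) (∣S-row∣≤k u′) (∈-light⁻ u∈A) (∈-light⁻ u′∈A)

    choose : ∃[ w ] All (w ∉_) excluded → ∃[ w ] (w ∈ B ─ Y × E u w ≡ true × E u′ w ≡ true)
    choose (w , w∉Y ∷ w∉∁B ∷ w∉Su ∷ w∉Su′ ∷ w∉Tu ∷ w∉Tu′ ∷ []) =
      w , x∈p∧x∉q⇒x∈p─q w∈B w∉Y ,
      edge⁺ u∈A w∈B (colour∈U (colour∉nbrs (f u) w∉Su) (colour∉nbrs (f u) w∉Tu)) ,
      edge⁺ u′∈A w∈B (colour∈U (colour∉nbrs (f u′) w∉Su′) (colour∉nbrs (f u′) w∉Tu′))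
      where
      w∈B : w ∈ B
      w∈B = x∉∁p⇒x∈p w∉∁B

  neighbour : 15 * k ≤ m → ∀ {v} (X : Subset m) → v ∈ B → ∣ X ∣ < k → ∃[ u ] (u ∈ A ─ X × E u v ≡ true)
  neighbour 15k≤m {v} X v∈B ∣X∣<k = choose (∑∣ps∣<n⇒∃x∉ps excluded budget)
    where
    excluded : List (Subset m)
    excluded = X List.∷ ∁ A List.∷ nbrsIn′ f T v List.∷ nbrsIn′ f S v List.∷ List.[]

    budget : sum (List.map ∣_∣ excluded) < m
    budget = neighbour-budget {s = ∣ nbrsIn′ f S v ∣} 15k≤m ∣X∣<k ∣∁A∣≤5k (∣T-column∣≤k v) (∈-light⁻ v∈B)

    choose : ∃[ u ] All (u ∉_) excluded → ∃[ u ] (u ∈ A ─ X × E u v ≡ true)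
    choose (u , u∉X ∷ u∉∁A ∷ u∉Tv ∷ u∉Sv ∷ []) =
      u , x∈p∧x∉q⇒x∈p─q u∈A u∉X ,
      edge⁺ u∈A v∈B (colour∈U (colour∉nbrs (λ u → f u v) u∉Sv) (colour∉nbrs (λ u → f u v) u∉Tv))
      where
      u∈A : u ∈ A
      u∈A = x∉∁p⇒x∈p u∉∁A

  k<∣A∣ : 1 ≤ k → 15 * k ≤ m → k < ∣ A ∣
  k<∣A∣ 1≤k 15k≤m = 15k≤a+5k⇒k<a 1≤k (begin
    15 * k                 ≤⟨ 15k≤m ⟩
    m                      ≤⟨ m≤n+m∸n m ∣ A ∣ ⟩
    ∣ A ∣ + (m ∸ ∣ A ∣)    ≡⟨ cong (∣ A ∣ +_) (∣∁p∣≡n∸∣p∣ A) ⟨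
    ∣ A ∣ + ∣ ∁ A ∣        ≤⟨ +-monoʳ-≤ ∣ A ∣ ∣∁A∣≤5k ⟩
    ∣ A ∣ + 5 * k          ∎)

  isKConnected : 1 ≤ k → 15 * k ≤ m → m ≤ n → KConnected k A B E
  isKConnected 1≤k 15k≤m m≤n = ≤-trans (k<∣A∣ 1≤k 15k≤m) (m≤m+n ∣ A ∣ ∣ B ∣) , connected
    where
    connected : ∀ X Y → X ⊆ A → Y ⊆ B → ∣ X ∣ + ∣ Y ∣ < k → Connected (A ─ X) (B ─ Y) E
    connected X Y _ _ ∣X∣+∣Y∣<k = connected-by-common-neighbours
      (λ u∈ u′∈ → common-neighbour (≤-trans 15k≤m m≤n) Y (p─q⊆p A X u∈) (p─q⊆p A X u′∈) ∣Y∣<k)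
      (λ v∈ → neighbour 15k≤m X (p─q⊆p B Y v∈) ∣X∣<k)
      where
      ∣X∣<k = ≤-<-trans (m≤m+n ∣ X ∣ ∣ Y ∣) ∣X∣+∣Y∣<k
      ∣Y∣<k = ≤-<-trans (m≤n+m ∣ Y ∣ ∣ X ∣) ∣X∣+∣Y∣<k

lemma2p7 : (k m n r : ℕ) → 1 ≤ k → 15 * k ≤ m → m ≤ n →
    (f : Fin m → Fin n → Fin r) → (S T U : Subset r) →
    (∀ c → c ∈ S ⊎ (c ∈ T ⊎ c ∈ U)) →
    (∀ u → ∣ nbrsIn f S u ∣ ≤ k) →
    (∀ v → ∣ nbrsIn′ f T v ∣ ≤ k) →
    Σ[ A ∈ Subset m ] Σ[ B ∈ Subset n ] Σ[ E ∈ EdgeSet m n ]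
      (IsUSubgraph f U A B E × KConnected k A B E ×
       ∣ ∁ A ∣ ≤ 5 * k × ∣ ∁ B ∣ ≤ 2 * k)
lemma2p7 k m n r 1≤k 15k≤m m≤n f S T U cover ∣S-row∣≤k ∣T-column∣≤k =
  A , B , E , E-isUSubgraph , isKConnected 1≤k 15k≤m m≤n , ∣∁A∣≤5k , ∣∁B∣≤2k
  where open Construction f S T U cover ∣S-row∣≤k ∣T-column∣≤k
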